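{- For any positive integers $k,l,m$ and $n$, the Toeplitz graphs $G_n(0^k1^l)$ and $G_n(1^l0^m)$ are word-representable.
   Context: For a word $a_1a_2\cdots a_p$ over $\{0,1\}$, the Toeplitz graph $G_n(a_1a_2\cdots a_p)$ is the simple graph on vertex set $[n]=\{1,\dots,n\}$ in which distinct vertices $x,y$ are adjacent if and only if $a_r=1$, where $r\in[p]$ is such that $r\equiv |x-y|\pmod p$. (Equivalently it is the Riordan graph $G_n\big(\frac{a_1+a_2z+\cdots+a_pz^{p-1}}{1-z^p},z\big)$.) For a letter $c$, $c^j$ denotes $c$ repeated $j$ times. Two distinct letters $x,y$ alternate in a word $w$ if deleting all other letters from $w$ yields a word of the form $xyxy\cdots$ or $yxyx\cdots$ (of even or odd length). A graph $G=(V,E)$ is word-representable if there is a word $w$ over the alphabet $V$ such that for all distinct $x,y\in V$, $x$ and $y$ alternate in $w$ if and only if $xy\in E$. -}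

module Defs where

open import Data.Nat using (ℕ; zero; suc; _+_; ∣_-_∣)
open import Data.Nat.Divisibility using (_∣_)
open import Data.Fin using (Fin; toℕ; _≟_)
open import Data.Vec using (Vec; replicate; _++_; lookup)
open import Data.List using (List; []; _∷_)
open import Data.List.Membership.Propositional using (_∈_)
open import Data.Bool using (Bool; true; false)
open import Data.Unit using (⊤)
open import Data.Product using (Σ; _×_)
open import Data.Sum using (_⊎_)
open import Relation.Nullary using (¬_; yes; no)
open import Relation.Binary.PropositionalEquality using (_≡_; _≢_)
open import Function.Bundles using (_⇔_)

Graph : ℕ → Set₁
Graph n = Fin n → Fin n → Set

-- Binary words: the word a₁a₂⋯a_p over {0,1} is a Vec Bool p
-- (false = 0, true = 1); a_r is  lookup a r'  with r' = r - 1 : Fin p.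

0^_1^_ : (k l : ℕ) → Vec Bool (k + l)
0^ k 1^ l = replicate k false ++ replicate l true

1^_0^_ : (l m : ℕ) → Vec Bool (l + m)
1^ l 0^ m = replicate l true ++ replicate m false

-- Vertex i : Fin n stands for i+1 ∈ [n]
-- (the shift does not change |x - y|).  Distinct x,y are adjacent iff
-- a_r = 1 where r ∈ [p] satisfies r ≡ |x - y| (mod p); here r = suc (toℕ r').
Toeplitz : {p : ℕ} → Vec Bool p → (n : ℕ) → Graph n
Toeplitz {p} a n x y =
  x ≢ y ×
  Σ (Fin p) λ r' →
    (p ∣ ∣ suc (toℕ r') - ∣ toℕ x - toℕ y ∣ ∣) × (lookup a r' ≡ true)

restrict : {n : ℕ} → Fin n → Fin n → List (Fin n) → List (Fin n)
restrict x y [] = []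
restrict x y (a ∷ w) with a ≟ x | a ≟ y
... | yes _ | _     = a ∷ restrict x y w
... | no _  | yes _ = a ∷ restrict x y w
... | no _  | no _  = restrict x y w

StartsAlt : {A : Set} → A → A → List A → Set
StartsAlt x y []      = ⊤
StartsAlt x y (a ∷ u) = (a ≡ x) × StartsAlt y x u

Alternate : {n : ℕ} → List (Fin n) → Fin n → Fin n → Set
Alternate w x y =
  StartsAlt x y (restrict x y w) ⊎ StartsAlt y x (restrict x y w)

WordRepresentable : {n : ℕ} → Graph n → Set
WordRepresentable {n} G =
  Σ (List (Fin n)) λ w →
    ((x : Fin n) → x ∈ w) ×
    ((x y : Fin n) → x ≢ y → (Alternate w x y ⇔ G x y))

-- Each vertex z becomes a clock: the letter z is written at the steps k at which
-- ⌊(k + offset z k) / P⌋ increases, so two letters alternate iff their tick counts never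
-- differ by more than one, always in the same order.  For constant offsets a (for x) and
-- b (for y) this holds throughout iff b ≤ a ≤ b + P.  Each offset jumps once, from
-- u z = ρ z · S + τ z to v z = u z + j · S + n, without moving the clock, and the jumps
-- happen one after the other in the order of the vertices.  Comparing x < y before,
-- between and after their jumps reduces alternation to lexicographic comparisons of
-- (ρ x, τ x), (ρ x + j, ·) and (ρ y, τ y).  Taking ρ x to be ∓ x modulo the period p of
-- the Toeplitz word, these comparisons say exactly that (y − x − 1) mod p falls in the
-- block of ones.
module Submission where

open import Data.Bool using (Bool; true; false)
open import Data.Empty using (⊥-elim)
open import Data.Fin using (Fin; toℕ; fromℕ<; reduce≥; opposite; _≟_)
open import Data.Fin.Properties
  using (toℕ-injective; toℕ<n; toℕ-fromℕ<; any?; opposite-prop; opposite-involutive)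
open import Data.List using (List; []; _∷_; _++_; [_]; length; filter)
open import Data.List.Membership.Propositional using (_∈_)
open import Data.List.Membership.Propositional.Properties using (∈-++⁺ˡ; ∈-++⁺ʳ)
open import Data.List.Properties
  using (++-assoc; ++-identityʳ; length-++; filter-++; filter-accept; filter-reject)
open import Data.List.Relation.Unary.Any using (here)
open import Data.Nat
  using (ℕ; zero; suc; _+_; _*_; _∸_; _/_; _%_; ∣_-_∣; _≤_; _<_; _≮_; z≤n; s≤s; s≤s⁻¹; z<s;
         _≤?_; _<?_; NonZero; >-nonZero; >-nonZero⁻¹)
open import Data.Nat.DivMod
open import Data.Nat.Divisibility using (_∣_; divides; ∣⇒≤; ∣m+n∣m⇒∣n; ∣-trans; n∣m*n)
open import Data.Nat.Properties renaming (_≟_ to _≟ℕ_)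
open import Data.Nat.Tactic.RingSolver using (solve-∀)
open import Data.Product using (∃; _×_; _,_)
open import Data.Product.Function.NonDependent.Propositional using (_×-⇔_)
open import Data.Sum using (_⊎_; inj₁; inj₂; swap; [_,_]′)
open import Data.Sum.Function.Propositional using (_⊎-⇔_)
open import Data.Unit using (tt)
open import Data.Vec using (Vec; lookup; replicate)
open import Data.Vec.Properties using (lookup-++-<; lookup-++-≥; lookup-replicate)
open import Function using (_∘_; id; flip)
open import Function.Bundles using (_⇔_; mk⇔; Equivalence)
open import Function.Construct.Composition using (_⇔-∘_)
open import Function.Construct.Symmetry using (⇔-sym)
open import Relation.Binary using (tri<; tri≈; tri>)
open import Relation.Binary.PropositionalEquality hiding ([_])
open import Relation.Nullary using (¬_; yes; no; contradiction)

open import Defs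

open Equivalence using (to; from)

-- Alternation and letter counts

Leads : ℕ → ℕ → Set
Leads i j = j ≤ i × i ≤ suc j

module _ {n : ℕ} where

  count : Fin n → List (Fin n) → ℕ
  count a w = length (filter (_≟ a) w)

  count-++ : ∀ a u v → count a (u ++ v) ≡ count a u + count a v
  count-++ a u v = trans (cong length (filter-++ (_≟ a) u v)) (length-++ (filter (_≟ a) u))

  count-∷-≡ : ∀ a w → count a (a ∷ w) ≡ suc (count a w)
  count-∷-≡ a w = cong length (filter-accept (_≟ a) refl)

  count-∷-≢ : ∀ {a b} w → b ≢ a → count a (b ∷ w) ≡ count a w
  count-∷-≢ {a} w b≢a = cong length (filter-reject (_≟ a) b≢a)

  count-∷-cong : ∀ {a} c {u v} → count a u ≡ count a v → count a (c ∷ u) ≡ count a (c ∷ v)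
  count-∷-cong {a} c {u} {v} eq =
    trans (count-++ a [ c ] u) (trans (cong (count a [ c ] +_) eq) (sym (count-++ a [ c ] v)))

  Balanced : Fin n → Fin n → List (Fin n) → Set
  Balanced a b w = Leads (count a w) (count b w)

  balanced-∷ : ∀ {a b} w → a ≢ b → Balanced a b (a ∷ w) ⇔ Balanced b a w
  balanced-∷ {a} {b} w a≢b
    rewrite count-∷-≡ a w | count-∷-≢ w a≢b =
    mk⇔ (λ (b≤1+a , 1+a≤1+b) → s≤s⁻¹ 1+a≤1+b , b≤1+a)
        (λ (a≤b , b≤1+a) → b≤1+a , s≤s a≤b)

  startsAlt⇒balanced : ∀ {a b} w → a ≢ b → StartsAlt a b w → Balanced a b w
  startsAlt⇒balanced []      a≢b _            = z≤n , z≤n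
  startsAlt⇒balanced (_ ∷ w) a≢b (refl , alt) =
    from (balanced-∷ w a≢b) (startsAlt⇒balanced w (≢-sym a≢b) alt)

  startsAlt-++⁻ˡ : ∀ {a b : Fin n} u v → StartsAlt a b (u ++ v) → StartsAlt a b u
  startsAlt-++⁻ˡ []      v _            = tt
  startsAlt-++⁻ˡ (_ ∷ u) v (eq , alt) = eq , startsAlt-++⁻ˡ u v alt

  AtMostOne : Fin n → Fin n → List (Fin n) → Set
  AtMostOne a b u = u ≡ [] ⊎ u ≡ [ a ] ⊎ u ≡ [ b ]

  startsAlt-++-single : ∀ {a b c} w → a ≢ b → c ≡ a ⊎ c ≡ b →
                        StartsAlt a b w → Balanced a b (w ++ [ c ]) → StartsAlt a b (w ++ [ c ])
  startsAlt-++-single []      a≢b (inj₁ c≡a) _ _ = c≡a , tt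
  startsAlt-++-single {a} {b} [] a≢b (inj₂ refl) _ (b≤a , _) =
    ⊥-elim (n≮0 (subst₂ _≤_ (count-∷-≡ b []) (count-∷-≢ [] (≢-sym a≢b)) b≤a))
  startsAlt-++-single {c = c} (_ ∷ w) a≢b c∈ab (refl , alt) bal =
    refl , startsAlt-++-single w (≢-sym a≢b) (swap c∈ab) alt (to (balanced-∷ (w ++ [ c ]) a≢b) bal)

  startsAlt-++-atMostOne : ∀ {a b u} w → a ≢ b → AtMostOne a b u →
                           StartsAlt a b w → Balanced a b (w ++ u) → StartsAlt a b (w ++ u)
  startsAlt-++-atMostOne w a≢b (inj₁ refl) alt _ rewrite ++-identityʳ w = alt
  startsAlt-++-atMostOne w a≢b (inj₂ (inj₁ refl)) = startsAlt-++-single w a≢b (inj₁ refl)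
  startsAlt-++-atMostOne w a≢b (inj₂ (inj₂ refl)) = startsAlt-++-single w a≢b (inj₂ refl)

module Accumulate {A : Set} (block : ℕ → List A) where

  upto : ℕ → List A
  upto zero    = []
  upto (suc k) = upto k ++ block k

  upto-prefix : ∀ {k E} → k ≤ E → ∃ λ s → upto E ≡ upto k ++ s
  upto-prefix {E = zero} z≤n = [] , refl
  upto-prefix {k} {suc E} k≤1+E with m≤n⇒m<n∨m≡n k≤1+E
  ... | inj₂ refl = [] , sym (++-identityʳ _)
  ... | inj₁ k<1+E with upto-prefix (s≤s⁻¹ k<1+E)
  ...   | s , eq = s ++ block E , trans (cong (_++ block E) eq) (++-assoc (upto k) s (block E))

module _ {n : ℕ} {a b : Fin n} (block : ℕ → List (Fin n)) (a≢b : a ≢ b)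
         (atMostOne : ∀ k → AtMostOne a b (block k)) where

  open Accumulate block

  startsAlt-upto⁻ : ∀ E → StartsAlt a b (upto E) → ∀ k → k ≤ E → Balanced a b (upto k)
  startsAlt-upto⁻ E alt k k≤E with upto-prefix k≤E
  ... | s , eq = startsAlt⇒balanced (upto k) a≢b (startsAlt-++⁻ˡ (upto k) s (subst (StartsAlt a b) eq alt))

  startsAlt-upto⁺ : ∀ E → (∀ k → k ≤ E → Balanced a b (upto k)) → StartsAlt a b (upto E)
  startsAlt-upto⁺ zero    _   = tt
  startsAlt-upto⁺ (suc E) bal =
    startsAlt-++-atMostOne (upto E) a≢b (atMostOne E)
      (startsAlt-upto⁺ E (λ k k≤E → bal k (m≤n⇒m≤1+n k≤E))) (bal (suc E) ≤-refl)

module _ {n : ℕ} where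

  restrict-++ : ∀ (x y : Fin n) u v → restrict x y (u ++ v) ≡ restrict x y u ++ restrict x y v
  restrict-++ x y []      v = refl
  restrict-++ x y (c ∷ u) v with c ≟ x | c ≟ y
  ... | yes _ | _     = cong (c ∷_) (restrict-++ x y u v)
  ... | no _  | yes _ = cong (c ∷_) (restrict-++ x y u v)
  ... | no _  | no _  = restrict-++ x y u v

  restrict-sym : ∀ (x y : Fin n) w → restrict x y w ≡ restrict y x w
  restrict-sym x y []      = refl
  restrict-sym x y (c ∷ w) with c ≟ x | c ≟ y
  ... | yes _ | yes _ = cong (c ∷_) (restrict-sym x y w)
  ... | yes _ | no _  = cong (c ∷_) (restrict-sym x y w)
  ... | no _  | yes _ = cong (c ∷_) (restrict-sym x y w)
  ... | no _  | no _  = restrict-sym x y w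

  count-restrict : ∀ {a x y : Fin n} w → a ≡ x ⊎ a ≡ y → count a (restrict x y w) ≡ count a w
  count-restrict {a} {x} {y} []      _    = refl
  count-restrict {a} {x} {y} (c ∷ w) a∈xy with c ≟ x | c ≟ y
  ... | yes _ | _     = count-∷-cong c (count-restrict w a∈xy)
  ... | no _  | yes _ = count-∷-cong c (count-restrict w a∈xy)
  ... | no c≢x | no c≢y = trans (count-restrict w a∈xy) (sym (count-∷-≢ w (c≢a a∈xy)))
    where
      c≢a : a ≡ x ⊎ a ≡ y → c ≢ a
      c≢a (inj₁ a≡x) c≡a = c≢x (trans c≡a a≡x)
      c≢a (inj₂ a≡y) c≡a = c≢y (trans c≡a a≡y)

  restrict-[_] : ∀ {x y : Fin n} z → AtMostOne x y (restrict x y [ z ])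
  restrict-[_] {x} {y} z with z ≟ x | z ≟ y
  ... | yes refl | _        = inj₂ (inj₁ refl)
  ... | no _     | yes refl = inj₂ (inj₂ refl)
  ... | no _     | no _     = inj₁ refl

  alternate-sym : ∀ w {x y : Fin n} → Alternate w x y → Alternate w y x
  alternate-sym w {x} {y} (inj₁ alt) = inj₂ (subst (StartsAlt x y) (restrict-sym x y w) alt)
  alternate-sym w {x} {y} (inj₂ alt) = inj₁ (subst (StartsAlt y x) (restrict-sym x y w) alt)

  wordRepresentable-by-< : (G : Graph n) → (∀ {x y} → G x y → G y x) →
    (w : List (Fin n)) → (∀ x → x ∈ w) →
    (∀ {x y} → toℕ x < toℕ y → Alternate w x y ⇔ G x y) → WordRepresentable G
  wordRepresentable-by-< G G-sym w ∈w alt⇔G = w , ∈w , alt⇔G≢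
    where
      alt⇔G≢ : ∀ x y → x ≢ y → Alternate w x y ⇔ G x y
      alt⇔G≢ x y x≢y with <-cmp (toℕ x) (toℕ y)
      ... | tri< x<y _ _ = alt⇔G x<y
      ... | tri≈ _ x≡y _ = ⊥-elim (x≢y (toℕ-injective x≡y))
      ... | tri> _ _ y<x = mk⇔ (λ alt → G-sym (to (alt⇔G y<x) (alternate-sym w alt)))
                               (λ g → alternate-sym w (from (alt⇔G y<x) (G-sym g)))

-- Words of ticking clocks

module ClockWord {n : ℕ} (clock : Fin n → ℕ → ℕ)
  (clock-zero : ∀ z → clock z 0 ≡ 0)
  (clock-step : ∀ z k → clock z (suc k) ≡ clock z k ⊎ clock z (suc k) ≡ suc (clock z k))
  (ticks-unique : ∀ {x y} k → clock x (suc k) ≡ suc (clock x k) →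
                               clock y (suc k) ≡ suc (clock y k) → x ≡ y)
  where

  Ticks : Fin n → ℕ → Set
  Ticks z k = clock z (suc k) ≡ suc (clock z k)

  clock-still : ∀ {z k} → ¬ Ticks z k → clock z (suc k) ≡ clock z k
  clock-still {z} {k} ¬tick with clock-step z k
  ... | inj₁ same = same
  ... | inj₂ tick = ⊥-elim (¬tick tick)

  block : ℕ → List (Fin n)
  block k with any? (λ z → clock z (suc k) ≟ℕ suc (clock z k))
  ... | yes (z , _) = [ z ]
  ... | no _        = []

  block-view : ∀ k → (block k ≡ [] × ∀ z → ¬ Ticks z k) ⊎ (∃ λ z → Ticks z k × block k ≡ [ z ])
  block-view k with any? (λ z → clock z (suc k) ≟ℕ suc (clock z k))
  ... | yes (z , tick) = inj₂ (z , tick , refl)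
  ... | no none        = inj₁ (refl , λ z tick → none (z , tick))

  block-ticks : ∀ {z k} → Ticks z k → block k ≡ [ z ]
  block-ticks {z} {k} tick with block-view k
  ... | inj₁ (_ , quiet)            = ⊥-elim (quiet z tick)
  ... | inj₂ (z′ , tick′ , block≡) = trans block≡ (cong [_] (ticks-unique k tick′ tick))

  clock-suc : ∀ x k → clock x (suc k) ≡ clock x k + count x (block k)
  clock-suc x k with block-view k
  ... | inj₁ (block≡ , quiet) rewrite block≡ = trans (clock-still (quiet x)) (sym (+-identityʳ _))
  ... | inj₂ (z , tick , block≡) rewrite block≡ with z ≟ x
  ...   | yes refl = trans tick (+-comm 1 _)
  ...   | no z≢x   = trans (clock-still (λ tickx → z≢x (ticks-unique k tick tickx)))
                           (sym (+-identityʳ _))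

  open Accumulate block public renaming (upto to word)

  count-word : ∀ x k → count x (word k) ≡ clock x k
  count-word x zero    = sym (clock-zero x)
  count-word x (suc k) = begin
    count x (word k ++ block k)         ≡⟨ count-++ x (word k) (block k) ⟩
    count x (word k) + count x (block k) ≡⟨ cong (_+ count x (block k)) (count-word x k) ⟩
    clock x k + count x (block k)        ≡⟨ sym (clock-suc x k) ⟩
    clock x (suc k)                      ∎
    where open ≡-Reasoning

  ∈-word : ∀ {z} E → 0 < clock z E → z ∈ word E
  ∈-word {z} zero    0<clock = ⊥-elim (n≮0 (subst (0 <_) (clock-zero z) 0<clock))
  ∈-word {z} (suc E) 0<clock with clock z (suc E) ≟ℕ suc (clock z E)
  ... | yes tick = ∈-++⁺ʳ (word E) (subst (z ∈_) (sym (block-ticks tick)) (here refl))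
  ... | no ¬tick = ∈-++⁺ˡ (∈-word E (subst (0 <_) (clock-still ¬tick) 0<clock))

  restrict-word : ∀ (x y : Fin n) k → restrict x y (word k) ≡ Accumulate.upto (restrict x y ∘ block) k
  restrict-word x y zero    = refl
  restrict-word x y (suc k) =
    trans (restrict-++ x y (word k) (block k)) (cong (_++ restrict x y (block k)) (restrict-word x y k))

  LeadsUntil : ℕ → Fin n → Fin n → Set
  LeadsUntil E x y = ∀ k → k ≤ E → Leads (clock x k) (clock y k)

  startsAlt-word⇔leadsUntil : ∀ {x y} E → x ≢ y → StartsAlt x y (restrict x y (word E)) ⇔ LeadsUntil E x y
  startsAlt-word⇔leadsUntil {x} {y} E x≢y =
    subst (λ w → StartsAlt x y w ⇔ LeadsUntil E x y) (sym (restrict-word x y E)) (mk⇔ necessary sufficient)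
    where
      block′ : ℕ → List (Fin n)
      block′ = restrict x y ∘ block

      atMostOne : ∀ k → AtMostOne x y (block′ k)
      atMostOne k with block-view k
      ... | inj₁ (block≡ , _)     rewrite block≡ = inj₁ refl
      ... | inj₂ (z , _ , block≡) rewrite block≡ = restrict-[ z ]

      balanced≡leads : ∀ k → Balanced x y (Accumulate.upto block′ k) ≡ Leads (clock x k) (clock y k)
      balanced≡leads k rewrite sym (restrict-word x y k) =
        cong₂ Leads (trans (count-restrict (word k) (inj₁ refl)) (count-word x k))
                    (trans (count-restrict (word k) (inj₂ refl)) (count-word y k))

      necessary : StartsAlt x y (Accumulate.upto block′ E) → LeadsUntil E x y
      necessary alt k k≤E = subst id (balanced≡leads k) (startsAlt-upto⁻ block′ x≢y atMostOne E alt k k≤E)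

      sufficient : LeadsUntil E x y → StartsAlt x y (Accumulate.upto block′ E)
      sufficient leads =
        startsAlt-upto⁺ block′ x≢y atMostOne E
          (λ k k≤E → subst id (sym (balanced≡leads k)) (leads k k≤E))

module _ (P : ℕ) .{{_ : NonZero P}} where

  [m+P]/P≡1+m/P : ∀ m → (m + P) / P ≡ suc (m / P)
  [m+P]/P≡1+m/P m = trans (m/n≡1+[m∸n]/n (m≤n+m P m)) (cong (suc ∘ (_/ P)) (m+n∸n≡m m P))

  [1+m]/P-cases : ∀ m → suc m / P ≡ m / P ⊎ suc m / P ≡ suc (m / P)
  [1+m]/P-cases m with m≤n⇒m<n∨m≡n (/-monoˡ-≤ P (n≤1+n m))
  ... | inj₂ same = inj₁ (sym same)
  ... | inj₁ more = inj₂ (≤-antisym at-most-one-more more)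
    where
      1+m≤m+P : suc m ≤ m + P
      1+m≤m+P = subst (_≤ m + P) (+-comm m 1) (+-monoʳ-≤ m (>-nonZero⁻¹ P))
      at-most-one-more : suc m / P ≤ suc (m / P)
      at-most-one-more = ≤-trans (/-monoˡ-≤ P 1+m≤m+P) (≤-reflexive ([m+P]/P≡1+m/P m))

  [1+m]/P≡1+m/P⇒P∣1+m : ∀ m → suc m / P ≡ suc (m / P) → P ∣ suc m
  [1+m]/P≡1+m/P⇒P∣1+m m tick = divides (suc (m / P)) (≤-antisym below above)
    where
      below : suc m ≤ suc (m / P) * P
      below = begin-strict
        m                   ≡⟨ m≡m%n+[m/n]*n m P ⟩
        m % P + m / P * P   <⟨ +-monoˡ-< (m / P * P) (m%n<n m P) ⟩
        P + m / P * P       ∎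
        where open ≤-Reasoning
      above : suc (m / P) * P ≤ suc m
      above = subst (λ q → q * P ≤ suc m) tick (m/n*n≤m (suc m) P)

  [qP+r]/P≡q : ∀ q {r} → r < P → (q * P + r) / P ≡ q
  [qP+r]/P≡q q {r} r<P = begin
    (q * P + r) / P     ≡⟨ +-distrib-/-∣ˡ r (divides q refl) ⟩
    q * P / P + r / P   ≡⟨ cong₂ _+_ (m*n/n≡m q P) (m<n⇒m/n≡0 r<P) ⟩
    q + 0               ≡⟨ +-identityʳ q ⟩
    q                   ∎
    where open ≡-Reasoning

  /-leads : ∀ k {a b} → b ≤ a → a ≤ b + P → Leads ((k + a) / P) ((k + b) / P)
  /-leads k {a} {b} b≤a a≤b+P =
    /-monoˡ-≤ P (+-monoʳ-≤ k b≤a) ,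
    ≤-trans (/-monoˡ-≤ P (≤-trans (+-monoʳ-≤ k a≤b+P) (≤-reflexive (sym (+-assoc k b P)))))
            (≤-reflexive ([m+P]/P≡1+m/P (k + b)))

  ≤/P⇒*P≤ : ∀ {K m} → K ≤ m / P → K * P ≤ m
  ≤/P⇒*P≤ {K} {m} K≤m/P = ≤-trans (*-monoˡ-≤ P K≤m/P) (m/n*n≤m m P)

  /-leads⇒≤ : ∀ t {a b} K → t + b ≡ K * P → Leads ((t + a) / P) ((t + b) / P) → b ≤ a
  /-leads⇒≤ t {a} {b} K t+b≡KP (b/P≤a/P , _) =
    +-cancelˡ-≤ t b a (≤-trans (≤-reflexive t+b≡KP) (≤/P⇒*P≤ K≤))
    where
      K≤ : K ≤ (t + a) / P
      K≤ = subst (_≤ (t + a) / P) (trans (cong (_/ P) t+b≡KP) (m*n/n≡m K P)) b/P≤a/P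

  /-leads⇒≤+P : ∀ t {a b} K → t + a ≡ K * P → Leads ((t + a) / P) ((t + b) / P) → a ≤ b + P
  /-leads⇒≤+P t {a} {b} K t+a≡KP (_ , a/P≤1+b/P) =
    +-cancelˡ-≤ t a (b + P) (begin
      t + a                ≡⟨ t+a≡KP ⟩
      K * P                ≤⟨ ≤/P⇒*P≤ K≤ ⟩
      t + b + P            ≡⟨ +-assoc t b P ⟩
      t + (b + P)          ∎)
    where
      open ≤-Reasoning
      K≤ : K ≤ (t + b + P) / P
      K≤ = subst₂ _≤_ (trans (cong (_/ P) t+a≡KP) (m*n/n≡m K P)) (sym ([m+P]/P≡1+m/P (t + b))) a/P≤1+b/P

module _ {S : ℕ} where

  *S+<*S : ∀ {a b r} → a < b → r < S → a * S + r < b * S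
  *S+<*S {a} {b} {r} a<b r<S = begin-strict
    a * S + r   <⟨ +-monoʳ-< (a * S) r<S ⟩
    a * S + S   ≡⟨ +-comm (a * S) S ⟩
    suc a * S   ≤⟨ *-monoˡ-≤ S a<b ⟩
    b * S       ∎
    where open ≤-Reasoning

  lex-≤ : ∀ {a b r r′} → r < S → r′ < S →
          a * S + r ≤ b * S + r′ ⇔ (a < b ⊎ (a ≡ b × r ≤ r′))
  lex-≤ {a} {b} {r} {r′} r<S r′<S = mk⇔ lex⁻ lex⁺
    where
      lex⁻ : a * S + r ≤ b * S + r′ → a < b ⊎ (a ≡ b × r ≤ r′)
      lex⁻ le with <-cmp a b
      ... | tri< a<b _ _    = inj₁ a<b
      ... | tri≈ _ refl _   = inj₂ (refl , +-cancelˡ-≤ (a * S) r r′ le)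
      ... | tri> _ _ b<a    = ⊥-elim (<⇒≱ (<-≤-trans (*S+<*S b<a r′<S) (m≤m+n (a * S) r)) le)
      lex⁺ : a < b ⊎ (a ≡ b × r ≤ r′) → a * S + r ≤ b * S + r′
      lex⁺ (inj₁ a<b)          = ≤-trans (<⇒≤ (*S+<*S a<b r<S)) (m≤m+n (b * S) r′)
      lex⁺ (inj₂ (refl , r≤r′)) = +-monoʳ-≤ (a * S) r≤r′

  lex-< : ∀ {a b r r′} → r′ < r → r < S → a * S + r ≤ b * S + r′ ⇔ a < b
  lex-< {a} {b} {r} {r′} r′<r r<S =
    mk⇔ (λ le → [ id , (λ (_ , r≤r′) → ⊥-elim (<⇒≱ r′<r r≤r′)) ]′ (to lex le))
        (λ a<b → from lex (inj₁ a<b))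
    where lex = lex-≤ {a} {b} r<S (<-trans r′<r r<S)

module _ {S : ℕ} .{{_ : NonZero S}} where

  ∣+∣⇒≮ : ∀ {m a b} → S ∣ m + a → S ∣ m + b → b < S → a ≮ b
  ∣+∣⇒≮ {m} {a} {b} S∣m+a S∣m+b b<S a<b = <⇒≱ (≤-<-trans (m∸n≤m b a) b<S) (∣⇒≤ S∣b∸a)
    where
      instance _ = >-nonZero (m<n⇒0<n∸m a<b)
      m+b≡m+a+[b∸a] : m + b ≡ m + a + (b ∸ a)
      m+b≡m+a+[b∸a] = trans (cong (m +_) (sym (m+[n∸m]≡n (<⇒≤ a<b)))) (sym (+-assoc m a (b ∸ a)))
      S∣b∸a : S ∣ b ∸ a
      S∣b∸a = ∣m+n∣m⇒∣n (subst (S ∣_) m+b≡m+a+[b∸a] S∣m+b) S∣m+a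

  ∣+∣⇒≡ : ∀ {m a b} → S ∣ m + a → S ∣ m + b → a < S → b < S → a ≡ b
  ∣+∣⇒≡ S∣m+a S∣m+b a<S b<S with <-cmp _ _
  ... | tri< a<b _ _ = ⊥-elim (∣+∣⇒≮ S∣m+a S∣m+b b<S a<b)
  ... | tri≈ _ a≡b _ = a≡b
  ... | tri> _ _ b<a = ⊥-elim (∣+∣⇒≮ S∣m+b S∣m+a a<S b<a)

-- Clocks whose offset jumps once

module PhaseClocks (n p j : ℕ) .{{_ : NonZero n}} .{{_ : NonZero p}} (ρ τ : Fin n → ℕ)
  (j<p : j < p) (ρ<p : ∀ z → ρ z < p) (τ<n : ∀ z → τ z < n)
  (τ-injective : ∀ {x y} → τ x ≡ τ y → x ≡ y) where

  S P : ℕ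
  S = 2 * n
  P = p * S

  instance
    S-nonZero : NonZero S
    S-nonZero = m*n≢0 2 n
    P-nonZero : NonZero P
    P-nonZero = m*n≢0 p S

  phase-gap : ℕ
  phase-gap = j * S + n

  -- Offsets are the pairs (ρ z, τ z) written in base S, so they compare lexicographically.
  u v : Fin n → ℕ
  u z = ρ z * S + τ z
  v z = (ρ z + j) * S + (τ z + n)

  v≡u+gap : ∀ z → v z ≡ u z + phase-gap
  v≡u+gap z = shuffle (ρ z) j S (τ z) n
    where
      shuffle : ∀ r j s t n → (r + j) * s + (t + n) ≡ r * s + t + (j * s + n)
      shuffle = solve-∀

  n<S : n < S
  n<S = subst (n <_) (cong (n +_) (sym (+-identityʳ n))) (m<m+n n (>-nonZero⁻¹ n))

  τ<S : ∀ z → τ z < S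
  τ<S z = <-trans (τ<n z) n<S

  τ+n<S : ∀ z → τ z + n < S
  τ+n<S z = subst (τ z + n <_) (cong (n +_) (sym (+-identityʳ n))) (+-monoˡ-< n (τ<n z))

  u<P : ∀ z → u z < P
  u<P z = *S+<*S (ρ<p z) (τ<S z)

  gap<P : phase-gap < P
  gap<P = *S+<*S j<p n<S

  u≤v : ∀ z → u z ≤ v z
  u≤v z = subst (u z ≤_) (sym (v≡u+gap z)) (m≤m+n (u z) phase-gap)

  u≤u+P : ∀ a b → u a ≤ u b + P
  u≤u+P a b = ≤-trans (<⇒≤ (u<P a)) (m≤n+m P (u b))

  u≤v+P : ∀ a b → u a ≤ v b + P
  u≤v+P a b = ≤-trans (<⇒≤ (u<P a)) (m≤n+m P (v b))

  v-mono : ∀ {a b} → u a ≤ u b → v a ≤ v b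
  v-mono {a} {b} le = subst₂ _≤_ (sym (v≡u+gap a)) (sym (v≡u+gap b)) (+-monoˡ-≤ phase-gap le)

  v-mono+P : ∀ {a b} → u a ≤ u b + P → v a ≤ v b + P
  v-mono+P {a} {b} le = begin
    v a                   ≡⟨ v≡u+gap a ⟩
    u a + phase-gap       ≤⟨ +-monoˡ-≤ phase-gap le ⟩
    u b + P + phase-gap   ≡⟨ +-assoc (u b) P phase-gap ⟩
    u b + (P + phase-gap) ≡⟨ cong (u b +_) (+-comm P phase-gap) ⟩
    u b + (phase-gap + P) ≡⟨ sym (+-assoc (u b) phase-gap P) ⟩
    u b + phase-gap + P   ≡⟨ cong (_+ P) (sym (v≡u+gap b)) ⟩
    v b + P               ∎
    where open ≤-Reasoning

  slot : Fin n → ℕ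
  slot z = 2 * toℕ z

  -- At the switch the clock of z reads 2 + slot z with either offset, since
  -- phase-gap < P; consecutive switches are at least a full period apart.
  switch : Fin n → ℕ
  switch z = (2 + slot z) * P ∸ u z

  horizon : ℕ
  horizon = (2 * n) * P

  switch+u : ∀ z → switch z + u z ≡ (2 + slot z) * P
  switch+u z = m∸n+n≡m (≤-trans (<⇒≤ (u<P z)) (m≤m+n P _))

  switch+v : ∀ z → switch z + v z ≡ (2 + slot z) * P + phase-gap
  switch+v z = begin
    switch z + v z                 ≡⟨ cong (switch z +_) (v≡u+gap z) ⟩
    switch z + (u z + phase-gap)   ≡⟨ sym (+-assoc (switch z) (u z) phase-gap) ⟩
    switch z + u z + phase-gap     ≡⟨ cong (_+ phase-gap) (switch+u z) ⟩
    (2 + slot z) * P + phase-gap   ∎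
    where open ≡-Reasoning

  switch≤ : ∀ z → switch z ≤ (2 + slot z) * P
  switch≤ z = m∸n≤m _ (u z)

  switch≥ : ∀ z → (1 + slot z) * P ≤ switch z
  switch≥ z = begin
    (1 + slot z) * P             ≡⟨ sym (m+n∸m≡n P _) ⟩
    (2 + slot z) * P ∸ P         ≤⟨ ∸-monoʳ-≤ _ (<⇒≤ (u<P z)) ⟩
    switch z                     ∎
    where open ≤-Reasoning

  P≤switch : ∀ z → P ≤ switch z
  P≤switch z = ≤-trans (m≤m+n P (slot z * P)) (switch≥ z)

  slot-gap : ∀ {x y} → toℕ x < toℕ y → 3 + slot x ≤ 1 + slot y
  slot-gap {x} {y} x<y = s≤s (subst (_≤ slot y) (*-suc 2 (toℕ x)) (*-monoʳ-≤ 2 x<y))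

  switch-< : ∀ {x y} → toℕ x < toℕ y → switch x < switch y
  switch-< {x} {y} x<y = begin-strict
    switch x             ≤⟨ switch≤ x ⟩
    (2 + slot x) * P     <⟨ m<n+m _ (>-nonZero⁻¹ P) ⟩
    (3 + slot x) * P     ≤⟨ *-monoˡ-≤ P (slot-gap x<y) ⟩
    (1 + slot y) * P     ≤⟨ switch≥ y ⟩
    switch y             ∎
    where open ≤-Reasoning

  switch≤horizon : ∀ z → switch z ≤ horizon
  switch≤horizon z =
    ≤-trans (switch≤ z) (*-monoˡ-≤ P (subst (_≤ 2 * n) (*-suc 2 (toℕ z)) (*-monoʳ-≤ 2 (toℕ<n z))))

  offset : Fin n → ℕ → ℕ
  offset z k with k ≤? switch z
  ... | yes _ = u z
  ... | no _  = v z

  residue : Fin n → ℕ → ℕ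
  residue z k with k ≤? switch z
  ... | yes _ = τ z
  ... | no _  = τ z + n

  offset≡*S+residue : ∀ z k → ∃ λ c → offset z k ≡ c * S + residue z k
  offset≡*S+residue z k with k ≤? switch z
  ... | yes _ = ρ z , refl
  ... | no _  = ρ z + j , refl

  offset-≤ : ∀ {z k} → k ≤ switch z → offset z k ≡ u z
  offset-≤ {z} {k} k≤s with k ≤? switch z
  ... | yes _   = refl
  ... | no k≰s  = ⊥-elim (k≰s k≤s)

  offset-> : ∀ {z k} → switch z < k → offset z k ≡ v z
  offset-> {z} {k} s<k with k ≤? switch z
  ... | yes k≤s = ⊥-elim (<⇒≱ s<k k≤s)
  ... | no _    = refl

  residue<S : ∀ z k → residue z k < S
  residue<S z k with k ≤? switch z
  ... | yes _ = τ<S z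
  ... | no _  = τ+n<S z

  residue-injective : ∀ {x y} k → residue x k ≡ residue y k → x ≡ y
  residue-injective {x} {y} k eq with k ≤? switch x | k ≤? switch y
  ... | yes _ | yes _ = τ-injective eq
  ... | yes _ | no _  = ⊥-elim (<⇒≢ (<-≤-trans (τ<n x) (m≤n+m n (τ y))) eq)
  ... | no _  | yes _ = ⊥-elim (<⇒≢ (<-≤-trans (τ<n y) (m≤n+m n (τ x))) (sym eq))
  ... | no _  | no _  = τ-injective (+-cancelʳ-≡ n (τ x) (τ y) eq)

  reading : ℕ → ℕ → ℕ
  reading k o = (k + o) / P

  clock : Fin n → ℕ → ℕ
  clock z k = reading k (offset z k)

  clock-zero : ∀ z → clock z 0 ≡ 0
  clock-zero z = trans (cong (_/ P) (offset-≤ z≤n)) (m<n⇒m/n≡0 (u<P z))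

  switch-invisible : ∀ z → (switch z + u z) / P ≡ (switch z + v z) / P
  switch-invisible z = begin
    (switch z + u z) / P                     ≡⟨ cong (_/ P) (switch+u z) ⟩
    (2 + slot z) * P / P                     ≡⟨ m*n/n≡m _ P ⟩
    2 + slot z                               ≡⟨ sym ([qP+r]/P≡q P _ gap<P) ⟩
    ((2 + slot z) * P + phase-gap) / P       ≡⟨ cong (_/ P) (sym (switch+v z)) ⟩
    (switch z + v z) / P                     ∎
    where open ≡-Reasoning

  clock-lag : ∀ z k → clock z k ≡ reading k (offset z (suc k))
  clock-lag z k with <-cmp k (switch z)
  ... | tri< k<s _ _  = cong (reading k) (trans (offset-≤ (<⇒≤ k<s)) (sym (offset-≤ k<s)))
  ... | tri≈ _ refl _ = trans (cong (reading k) (offset-≤ ≤-refl))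
                              (trans (switch-invisible z) (cong (reading k) (sym (offset-> ≤-refl))))
  ... | tri> _ _ s<k  = cong (reading k) (trans (offset-> s<k) (sym (offset-> (m≤n⇒m≤1+n s<k))))

  clock-step : ∀ z k → clock z (suc k) ≡ clock z k ⊎ clock z (suc k) ≡ suc (clock z k)
  clock-step z k rewrite clock-lag z k = [1+m]/P-cases P (k + offset z (suc k))

  -- A tick of z at step k gives P ∣ 1 + k + offset z (1 + k), hence S ∣ 1 + k + residue z (1 + k),
  -- and residues of distinct letters are distinct numbers below S.
  ticks-unique : ∀ {x y} k → clock x (suc k) ≡ suc (clock x k) →
                             clock y (suc k) ≡ suc (clock y k) → x ≡ y
  ticks-unique {x} {y} k tickx ticky =
    residue-injective (suc k)
      (∣+∣⇒≡ (S∣ x tickx) (S∣ y ticky) (residue<S x (suc k)) (residue<S y (suc k)))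
    where
      S∣ : ∀ z → clock z (suc k) ≡ suc (clock z k) → S ∣ suc k + residue z (suc k)
      S∣ z tick with offset≡*S+residue z (suc k)
      ... | c , eq = ∣m+n∣m⇒∣n (subst (S ∣_) regroup S∣P∣) (n∣m*n c)
        where
          S∣P∣ : S ∣ suc k + offset z (suc k)
          S∣P∣ = ∣-trans (n∣m*n p)
                   ([1+m]/P≡1+m/P⇒P∣1+m P (k + offset z (suc k)) (trans tick (cong suc (clock-lag z k))))
          shuffle : ∀ m c s r → m + (c * s + r) ≡ c * s + (m + r)
          shuffle = solve-∀
          regroup : suc k + offset z (suc k) ≡ c * S + (suc k + residue z (suc k))
          regroup = trans (cong (suc k +_) eq) (shuffle (suc k) c S (residue z (suc k)))

  open ClockWord clock clock-zero clock-step ticks-unique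

  offsets : ∀ {x y} → toℕ x < toℕ y → ∀ k →
    (offset x k ≡ u x × offset y k ≡ u y) ⊎
    (offset x k ≡ v x × offset y k ≡ u y) ⊎
    (offset x k ≡ v x × offset y k ≡ v y)
  offsets {x} {y} x<y k with ≤-<-connex k (switch x) | ≤-<-connex k (switch y)
  ... | inj₁ k≤sx | _         = inj₁ (offset-≤ k≤sx , offset-≤ (<⇒≤ (≤-<-trans k≤sx (switch-< x<y))))
  ... | inj₂ sx<k | inj₁ k≤sy = inj₂ (inj₁ (offset-> sx<k , offset-≤ k≤sy))
  ... | inj₂ sx<k | inj₂ sy<k = inj₂ (inj₂ (offset-> sx<k , offset-> sy<k))

  leads-offsets : ∀ x y k {a b} → offset x k ≡ a → offset y k ≡ b →
    Leads (clock x k) (clock y k) ⇔ Leads (reading k a) (reading k b)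
  leads-offsets x y k refl refl = mk⇔ id id

  -- At probe₁ y (before every switch) the clock of y reads exactly 1, at probe₂ x (between
  -- the switches of x and y) the clock of x reads exactly 3 + slot x: the Leads conditions
  -- there are the inequalities between offsets.
  probe₁ : Fin n → ℕ
  probe₁ y = P ∸ u y

  probe₁+u : ∀ y → probe₁ y + u y ≡ 1 * P
  probe₁+u y = trans (m∸n+n≡m (<⇒≤ (u<P y))) (sym (*-identityˡ P))

  probe₁≤switch : ∀ y z → probe₁ y ≤ switch z
  probe₁≤switch y z = ≤-trans (m∸n≤m P (u y)) (P≤switch z)

  probe₂ : Fin n → ℕ
  probe₂ x = (3 + slot x) * P ∸ v x

  switch+v< : ∀ x → switch x + v x < (3 + slot x) * P
  switch+v< x = begin-strict
    switch x + v x                ≡⟨ switch+v x ⟩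
    (2 + slot x) * P + phase-gap  <⟨ +-monoʳ-< _ gap<P ⟩
    (2 + slot x) * P + P          ≡⟨ +-comm _ P ⟩
    (3 + slot x) * P              ∎
    where open ≤-Reasoning

  probe₂+v : ∀ x → probe₂ x + v x ≡ (3 + slot x) * P
  probe₂+v x = m∸n+n≡m (≤-trans (m≤n+m (v x) (switch x)) (<⇒≤ (switch+v< x)))

  switch<probe₂ : ∀ x → switch x < probe₂ x
  switch<probe₂ x =
    +-cancelʳ-< (v x) (switch x) (probe₂ x) (subst (switch x + v x <_) (sym (probe₂+v x)) (switch+v< x))

  probe₂≤switch : ∀ {x y} → toℕ x < toℕ y → probe₂ x ≤ switch y
  probe₂≤switch {x} {y} x<y =
    ≤-trans (m∸n≤m _ (v x)) (≤-trans (*-monoˡ-≤ P (slot-gap x<y)) (switch≥ y))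

  XLeads YLeads : Fin n → Fin n → Set
  XLeads x y = u y ≤ u x × v x ≤ u y + P
  YLeads x y = v x ≤ u y

  leads⇔xLeads : ∀ {x y} → toℕ x < toℕ y → LeadsUntil horizon x y ⇔ XLeads x y
  leads⇔xLeads {x} {y} x<y = mk⇔ necessary sufficient
    where
      necessary : LeadsUntil horizon x y → XLeads x y
      necessary leads =
        /-leads⇒≤ P (probe₁ y) 1 (probe₁+u y)
          (to (leads-offsets x y (probe₁ y) (offset-≤ (probe₁≤switch y x)) (offset-≤ (probe₁≤switch y y)))
              (leads (probe₁ y) (≤-trans (probe₁≤switch y x) (switch≤horizon x)))) ,
        /-leads⇒≤+P P (probe₂ x) (3 + slot x) (probe₂+v x)
          (to (leads-offsets x y (probe₂ x) (offset-> (switch<probe₂ x)) (offset-≤ (probe₂≤switch x<y)))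
              (leads (probe₂ x) (≤-trans (probe₂≤switch x<y) (switch≤horizon y))))
      sufficient : XLeads x y → LeadsUntil horizon x y
      sufficient (uy≤ux , vx≤uy+P) k _ with offsets x<y k
      ... | inj₁ (ox , oy)        = from (leads-offsets x y k ox oy) (/-leads P k uy≤ux (u≤u+P x y))
      ... | inj₂ (inj₁ (ox , oy)) =
        from (leads-offsets x y k ox oy) (/-leads P k (≤-trans uy≤ux (u≤v x)) vx≤uy+P)
      ... | inj₂ (inj₂ (ox , oy)) =
        from (leads-offsets x y k ox oy) (/-leads P k (v-mono uy≤ux) (v-mono+P (u≤u+P x y)))

  leads⇔yLeads : ∀ {x y} → toℕ x < toℕ y → LeadsUntil horizon y x ⇔ YLeads x y
  leads⇔yLeads {x} {y} x<y = mk⇔ necessary sufficient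
    where
      necessary : LeadsUntil horizon y x → YLeads x y
      necessary leads =
        /-leads⇒≤ P (probe₂ x) (3 + slot x) (probe₂+v x)
          (to (leads-offsets y x (probe₂ x) (offset-≤ (probe₂≤switch x<y)) (offset-> (switch<probe₂ x)))
              (leads (probe₂ x) (≤-trans (probe₂≤switch x<y) (switch≤horizon y))))
      sufficient : YLeads x y → LeadsUntil horizon y x
      sufficient vx≤uy k _ with offsets x<y k
      ... | inj₁ (ox , oy) =
        from (leads-offsets y x k oy ox) (/-leads P k (≤-trans (u≤v x) vx≤uy) (u≤u+P y x))
      ... | inj₂ (inj₁ (ox , oy)) = from (leads-offsets y x k oy ox) (/-leads P k vx≤uy (u≤v+P y x))
      ... | inj₂ (inj₂ (ox , oy)) =
        from (leads-offsets y x k oy ox) (/-leads P k (v-mono (≤-trans (u≤v x) vx≤uy)) (v-mono+P (u≤u+P y x)))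

  XFirst YFirst : Fin n → Fin n → Set
  XFirst x y = (ρ y < ρ x ⊎ (ρ y ≡ ρ x × τ y ≤ τ x)) × ρ x + j < ρ y + p
  YFirst x y = ρ x + j < ρ y

  τ<τ+n : ∀ y x → τ y < τ x + n
  τ<τ+n y x = <-≤-trans (τ<n y) (m≤n+m n (τ x))

  u≤u⇔ : ∀ x y → u y ≤ u x ⇔ (ρ y < ρ x ⊎ (ρ y ≡ ρ x × τ y ≤ τ x))
  u≤u⇔ x y = lex-≤ (τ<S y) (τ<S x)

  v≤u⇔ : ∀ x y → v x ≤ u y ⇔ ρ x + j < ρ y
  v≤u⇔ x y = lex-< (τ<τ+n y x) (τ+n<S x)

  v≤u+P⇔ : ∀ x y → v x ≤ u y + P ⇔ ρ x + j < ρ y + p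
  v≤u+P⇔ x y = subst (λ m → v x ≤ m ⇔ ρ x + j < ρ y + p) (sym (shuffle (ρ y) (τ y) p S))
                     (lex-< (τ<τ+n y x) (τ+n<S x))
    where
      shuffle : ∀ r t p s → r * s + t + p * s ≡ (r + p) * s + t
      shuffle = solve-∀

  alternate⇔ : ∀ {x y} → toℕ x < toℕ y → Alternate (word horizon) x y ⇔ (XFirst x y ⊎ YFirst x y)
  alternate⇔ {x} {y} x<y = xFirst ⊎-⇔ yFirst
    where
      x≢y : x ≢ y
      x≢y x≡y = <-irrefl (cong toℕ x≡y) x<y
      xFirst : StartsAlt x y (restrict x y (word horizon)) ⇔ XFirst x y
      xFirst = (u≤u⇔ x y ×-⇔ v≤u+P⇔ x y)
           ⇔-∘ (leads⇔xLeads x<y ⇔-∘ startsAlt-word⇔leadsUntil horizon x≢y)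
      yFirst : StartsAlt y x (restrict x y (word horizon)) ⇔ YFirst x y
      yFirst = subst (λ w → StartsAlt y x w ⇔ YFirst x y) (restrict-sym y x (word horizon))
                 (v≤u⇔ x y ⇔-∘ (leads⇔yLeads x<y ⇔-∘ startsAlt-word⇔leadsUntil horizon (≢-sym x≢y)))

  ∈-word-horizon : ∀ z → z ∈ word horizon
  ∈-word-horizon z =
    ∈-word horizon (<-≤-trans 0<horizon/P (/-monoˡ-≤ P (m≤m+n horizon (offset z horizon))))
    where
      0<horizon/P : 0 < horizon / P
      0<horizon/P = subst (0 <_) (sym (m*n/n≡m (2 * n) P)) (>-nonZero⁻¹ S)

  wordRepresentable : (G : Graph n) → (∀ {x y} → G x y → G y x) →
    (∀ {x y} → toℕ x < toℕ y → G x y ⇔ (XFirst x y ⊎ YFirst x y)) → WordRepresentable G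
  wordRepresentable G G-sym G⇔ =
    wordRepresentable-by-< G G-sym (word horizon) ∈-word-horizon
      (λ x<y → ⇔-sym (G⇔ x<y) ⇔-∘ alternate⇔ x<y)

-- Toeplitz adjacency

module _ {p : ℕ} .{{_ : NonZero p}} where

  ∣n∸m⇒n%p≡m%p : ∀ {a b} → a ≤ b → p ∣ b ∸ a → b % p ≡ a % p
  ∣n∸m⇒n%p≡m%p {a} {b} a≤b p∣b∸a =
    trans (cong (_% p) (sym (m+[n∸m]≡n a≤b))) (%-remove-+ʳ a p∣b∸a)

  ∣∣m-n∣⇒m%p≡n%p : ∀ a b → p ∣ ∣ a - b ∣ → a % p ≡ b % p
  ∣∣m-n∣⇒m%p≡n%p a b p∣ with ≤-total a b
  ... | inj₁ a≤b = sym (∣n∸m⇒n%p≡m%p a≤b (subst (p ∣_) (m≤n⇒∣m-n∣≡n∸m a≤b) p∣))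
  ... | inj₂ b≤a = ∣n∸m⇒n%p≡m%p b≤a (subst (p ∣_) (m≤n⇒∣n-m∣≡n∸m b≤a) p∣)

  ∣∣m%p-m∣ : ∀ a → p ∣ ∣ a % p - a ∣
  ∣∣m%p-m∣ a = divides (a / p) (begin
    ∣ a % p - a ∣        ≡⟨ m≤n⇒∣m-n∣≡n∸m (m%n≤m a p) ⟩
    a ∸ a % p            ≡⟨ cong (a ∸_) (m%n≡m∸m/n*n a p) ⟩
    a ∸ (a ∸ a / p * p)  ≡⟨ m∸[m∸n]≡n (m/n*n≤m a p) ⟩
    a / p * p            ∎)
    where open ≡-Reasoning

  [1+m%p]%p : ∀ m → suc (m % p) % p ≡ suc m % p
  [1+m%p]%p m = begin
    (1 + m % p) % p            ≡⟨ %-distribˡ-+ 1 (m % p) p ⟩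
    (1 % p + m % p % p) % p    ≡⟨ cong (λ q → (1 % p + q) % p) (m%n%n≡m%n m p) ⟩
    (1 % p + m % p) % p        ≡⟨ sym (%-distribˡ-+ 1 m p) ⟩
    (1 + m) % p                ∎
    where open ≡-Reasoning

  %-shift : ∀ a e → (a + suc e) % p ≡ (a % p + suc (e % p)) % p
  %-shift a e = begin
    (a + suc e) % p                      ≡⟨ %-distribˡ-+ a (suc e) p ⟩
    (a % p + suc e % p) % p              ≡⟨ cong (λ q → (q + suc e % p) % p) (sym (m%n%n≡m%n a p)) ⟩
    (a % p % p + suc e % p) % p          ≡⟨ cong (λ q → (a % p % p + q) % p) (sym ([1+m%p]%p e)) ⟩
    (a % p % p + suc (e % p) % p) % p    ≡⟨ sym (%-distribˡ-+ (a % p) (suc (e % p)) p) ⟩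
    (a % p + suc (e % p)) % p            ∎
    where open ≡-Reasoning

  %-wrap : ∀ {a s} → a < p → s ≤ p → (a + s) % p ≡ a + s ⊎ (a + s) % p + p ≡ a + s
  %-wrap {a} {s} a<p s≤p with a + s <? p
  ... | yes a+s<p = inj₁ (m<n⇒m%n≡m a+s<p)
  ... | no a+s≮p  = inj₂ (trans (cong (_+ p) [a+s]%p≡a+s∸p) (m∸n+n≡m p≤a+s))
    where
      p≤a+s : p ≤ a + s
      p≤a+s = ≮⇒≥ a+s≮p
      a+s∸p<p : a + s ∸ p < p
      a+s∸p<p = +-cancelʳ-< p (a + s ∸ p) p
                  (subst (_< p + p) (sym (m∸n+n≡m p≤a+s)) (+-mono-<-≤ a<p s≤p))
      [a+s]%p≡a+s∸p : (a + s) % p ≡ a + s ∸ p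
      [a+s]%p≡a+s∸p = trans (sym (m≤n⇒[n∸m]%m≡n%m p≤a+s)) (m<n⇒m%n≡m a+s∸p<p)

  [a+1+e]%p-cases : ∀ a e → let b = (a + suc e) % p ; s = suc (e % p) in
           b ≡ a % p + s ⊎ b + p ≡ a % p + s
  [a+1+e]%p-cases a e rewrite %-shift a e = %-wrap (m%n<n a p) (m%n<n e p)

  module _ {n : ℕ} (a : Vec Bool p) where

    toeplitz-< : ∀ {x y : Fin n} e → toℕ y ≡ toℕ x + suc e →
                 Toeplitz a n x y ⇔ lookup a (fromℕ< (m%n<n e p)) ≡ true
    toeplitz-< {x} {y} e y≡x+1+e = mk⇔ adjacent⇒ ⇒adjacent
      where
        distance : ∣ toℕ x - toℕ y ∣ ≡ suc e
        distance = trans (m≤n⇒∣m-n∣≡n∸m (subst (toℕ x ≤_) (sym y≡x+1+e) (m≤m+n (toℕ x) (suc e))))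
                         (trans (cong (_∸ toℕ x) y≡x+1+e) (m+n∸m≡n (toℕ x) (suc e)))
        x≢y : x ≢ y
        x≢y refl = 1+n≢0 (trans (sym distance) (m≡n⇒∣m-n∣≡0 {toℕ x} refl))
        adjacent⇒ : Toeplitz a n x y → lookup a (fromℕ< (m%n<n e p)) ≡ true
        adjacent⇒ (_ , r , p∣ , ar≡true) = subst (λ i → lookup a i ≡ true) r≡ ar≡true
          where
            r≡ : r ≡ fromℕ< (m%n<n e p)
            r≡ = toℕ-injective (begin
              toℕ r      ≡⟨ sym (m<n⇒m%n≡m (toℕ<n r)) ⟩
              toℕ r % p  ≡⟨ ∣∣m-n∣⇒m%p≡n%p (toℕ r) e (subst (λ d → p ∣ ∣ suc (toℕ r) - d ∣) distance p∣) ⟩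
              e % p      ≡⟨ sym (toℕ-fromℕ< (m%n<n e p)) ⟩
              toℕ (fromℕ< (m%n<n e p)) ∎)
              where open ≡-Reasoning
        ⇒adjacent : lookup a (fromℕ< (m%n<n e p)) ≡ true → Toeplitz a n x y
        ⇒adjacent ai≡true = x≢y , fromℕ< (m%n<n e p) , p∣ , ai≡true
          where
            p∣ : p ∣ ∣ suc (toℕ (fromℕ< (m%n<n e p))) - ∣ toℕ x - toℕ y ∣ ∣
            p∣ rewrite toℕ-fromℕ< (m%n<n e p) | distance = ∣∣m%p-m∣ e

toeplitz-sym : ∀ {p n} (a : Vec Bool p) {x y : Fin n} → Toeplitz a n x y → Toeplitz a n y x
toeplitz-sym {p} a {x} {y} (x≢y , r , p∣ , ar≡true) =
  ≢-sym x≢y , r , subst (λ d → p ∣ ∣ suc (toℕ r) - d ∣) (∣-∣-comm (toℕ x) (toℕ y)) p∣ , ar≡true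

lookup-1^0^ : ∀ l m (i : Fin (l + m)) → lookup (1^ l 0^ m) i ≡ true ⇔ toℕ i < l
lookup-1^0^ l m i with toℕ i <? l
... | yes i<l = mk⇔ (λ _ → i<l)
                    (λ _ → trans (lookup-++-< (replicate l true) (replicate m false) i i<l)
                                 (lookup-replicate (fromℕ< i<l) true))
... | no i≮l  = mk⇔ (λ ai≡true → contradiction (trans (sym ai≡false) ai≡true) λ ()) (flip contradiction i≮l)
  where
    ai≡false : lookup (1^ l 0^ m) i ≡ false
    ai≡false = trans (lookup-++-≥ (replicate l true) (replicate m false) i (≮⇒≥ i≮l))
                     (lookup-replicate (reduce≥ i (≮⇒≥ i≮l)) false)

lookup-0^1^ : ∀ k l (i : Fin (k + l)) → lookup (0^ k 1^ l) i ≡ true ⇔ k ≤ toℕ i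
lookup-0^1^ k l i with toℕ i <? k
... | yes i<k = mk⇔ (λ ai≡true → contradiction (trans (sym ai≡false) ai≡true) λ ()) (contradiction i<k ∘ ≤⇒≯)
  where
    ai≡false : lookup (0^ k 1^ l) i ≡ false
    ai≡false = trans (lookup-++-< (replicate k false) (replicate l true) i i<k)
                     (lookup-replicate (fromℕ< i<k) false)
... | no i≮k  = mk⇔ (λ _ → ≮⇒≥ i≮k)
                    (λ _ → trans (lookup-++-≥ (replicate k false) (replicate l true) i (≮⇒≥ i≮k))
                                 (lookup-replicate (reduce≥ i (≮⇒≥ i≮k)) true))

module _ {n : ℕ} {x y : Fin n} (e : ℕ) (y≡x+1+e : toℕ y ≡ toℕ x + suc e) where

  toeplitz-1^0^ : ∀ l m .{{_ : NonZero (l + m)}} → Toeplitz (1^ l 0^ m) n x y ⇔ e % (l + m) < l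
  toeplitz-1^0^ l m =
    subst (λ t → lookup (1^ l 0^ m) i ≡ true ⇔ t < l) (toℕ-fromℕ< _) (lookup-1^0^ l m i)
      ⇔-∘ toeplitz-< (1^ l 0^ m) e y≡x+1+e
    where i = fromℕ< (m%n<n e (l + m))

  toeplitz-0^1^ : ∀ k l .{{_ : NonZero (k + l)}} → Toeplitz (0^ k 1^ l) n x y ⇔ k < suc (e % (k + l))
  toeplitz-0^1^ k l =
    mk⇔ s≤s s≤s⁻¹
      ⇔-∘ (subst (λ t → lookup (0^ k 1^ l) i ≡ true ⇔ k ≤ t) (toℕ-fromℕ< _) (lookup-0^1^ k l i)
      ⇔-∘ toeplitz-< (0^ k 1^ l) e y≡x+1+e)
    where i = fromℕ< (m%n<n e (k + l))

<⇒≡+suc : ∀ {m n} → m < n → ∃ λ e → n ≡ m + suc e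
<⇒≡+suc {m} m<n with m≤n⇒∃[o]m+o≡n m<n
... | e , 1+m+e≡n = e , sym (trans (+-suc m e) 1+m+e≡n)

m∸n≡m∸[n+o]+o : ∀ {N b d} → b + d ≤ N → N ∸ b ≡ N ∸ (b + d) + d
m∸n≡m∸[n+o]+o {N} {b} {d} b+d≤N = begin
  N ∸ b                          ≡⟨ cong (_∸ b) (sym (m∸n+n≡m b+d≤N)) ⟩
  N ∸ (b + d) + (b + d) ∸ b      ≡⟨ +-∸-assoc (N ∸ (b + d)) (m≤m+n b d) ⟩
  N ∸ (b + d) + (b + d ∸ b)      ≡⟨ cong (N ∸ (b + d) +_) (m+n∸m≡n b d) ⟩
  N ∸ (b + d) + d                ∎
  where open ≡-Reasoning

b+[s+j]<b+[l+1+j]⇔s≤l : ∀ b s j l → b + (s + j) < b + (l + suc j) ⇔ s ≤ l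
b+[s+j]<b+[l+1+j]⇔s≤l b s j l = mk⇔
  (λ lt → +-cancelʳ-≤ j s l (s≤s⁻¹ (subst (suc (s + j) ≤_) (+-suc l j) (+-cancelˡ-< b (s + j) _ lt))))
  (λ s≤l → +-monoʳ-< b (subst (suc (s + j) ≤_) (sym (+-suc l j)) (s≤s (+-monoˡ-≤ j s≤l))))

first⇔-1^0^ : ∀ {a b s j l tx ty} → tx < ty → 0 < s → s ≤ l + suc j →
  (a ≡ b + s ⊎ a + (l + suc j) ≡ b + s) →
  (((b < a ⊎ (b ≡ a × ty ≤ tx)) × a + j < b + (l + suc j)) ⊎ a + j < b) ⇔ s ≤ l
first⇔-1^0^ {b = b} {s} {j} {l} tx<ty 0<s s≤p (inj₁ refl) = mk⇔ necessary sufficient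
  where
    key = b+[s+j]<b+[l+1+j]⇔s≤l b s j l
    necessary : _ → s ≤ l
    necessary (inj₁ (_ , lt)) = to key (subst (_< b + (l + suc j)) (+-assoc b s j) lt)
    necessary (inj₂ lt)       = ⊥-elim (<⇒≱ lt (≤-trans (m≤m+n b s) (m≤m+n (b + s) j)))
    sufficient : s ≤ l → _
    sufficient s≤l =
      inj₁ (inj₁ (m<m+n b 0<s) , subst (_< b + (l + suc j)) (sym (+-assoc b s j)) (from key s≤l))
first⇔-1^0^ {a} {b} {s} {j} {l} tx<ty 0<s s≤p (inj₂ a+p≡b+s) = mk⇔ necessary sufficient
  where
    p = l + suc j
    key = b+[s+j]<b+[l+1+j]⇔s≤l b s j l
    a+j+p≡b+[s+j] : a + j + p ≡ b + (s + j)
    a+j+p≡b+[s+j] = begin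
      a + j + p     ≡⟨ +-assoc a j p ⟩
      a + (j + p)   ≡⟨ cong (a +_) (+-comm j p) ⟩
      a + (p + j)   ≡⟨ sym (+-assoc a p j) ⟩
      a + p + j     ≡⟨ cong (_+ j) a+p≡b+s ⟩
      b + s + j     ≡⟨ +-assoc b s j ⟩
      b + (s + j)   ∎
      where open ≡-Reasoning
    a≤b : a ≤ b
    a≤b = +-cancelʳ-≤ p a b (subst (_≤ b + p) (sym a+p≡b+s) (+-monoʳ-≤ b s≤p))
    necessary : _ → s ≤ l
    necessary (inj₁ (inj₁ b<a , _))         = ⊥-elim (<⇒≱ b<a a≤b)
    necessary (inj₁ (inj₂ (_ , ty≤tx) , _)) = ⊥-elim (<⇒≱ tx<ty ty≤tx)
    necessary (inj₂ a+j<b)                  = to key (subst (_< b + p) a+j+p≡b+[s+j] (+-monoˡ-< p a+j<b))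
    sufficient : s ≤ l → _
    sufficient s≤l = inj₂ (+-cancelʳ-< p (a + j) b (subst (_< b + p) (sym a+j+p≡b+[s+j]) (from key s≤l)))

first⇔-0^1^ : ∀ {a b s j p tx ty} → ty < tx → 0 < s → s ≤ p → (b ≡ a + s ⊎ b + p ≡ a + s) →
  (((b < a ⊎ (b ≡ a × ty ≤ tx)) × a + j < b + p) ⊎ a + j < b) ⇔ j < s
first⇔-0^1^ {a} {s = s} {j} ty<tx 0<s s≤p (inj₁ refl) = mk⇔ necessary sufficient
  where
    necessary : _ → j < s
    necessary (inj₁ (inj₁ a+s<a , _))       = ⊥-elim (<⇒≱ a+s<a (m≤m+n a s))
    necessary (inj₁ (inj₂ (a+s≡a , _) , _)) = ⊥-elim (<⇒≢ (m<m+n a 0<s) (sym a+s≡a))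
    necessary (inj₂ a+j<a+s)                = +-cancelˡ-< a j s a+j<a+s
    sufficient : j < s → _
    sufficient j<s = inj₂ (+-monoʳ-< a j<s)
first⇔-0^1^ {a} {b} {s} {j} {p} ty<tx 0<s s≤p (inj₂ b+p≡a+s) = mk⇔ necessary sufficient
  where
    b≤a : b ≤ a
    b≤a = +-cancelʳ-≤ p b a (subst (_≤ a + p) (sym b+p≡a+s) (+-monoʳ-≤ a s≤p))
    necessary : _ → j < s
    necessary (inj₁ (_ , a+j<b+p)) = +-cancelˡ-< a j s (subst (a + j <_) b+p≡a+s a+j<b+p)
    necessary (inj₂ a+j<b)         = ⊥-elim (<⇒≱ (≤-<-trans (m≤m+n a j) a+j<b) b≤a)
    sufficient : j < s → _
    sufficient j<s =
      inj₁ (b≤a⇒ (m≤n⇒m<n∨m≡n b≤a) , subst (a + j <_) (sym b+p≡a+s) (+-monoʳ-< a j<s))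
      where
        b≤a⇒ : b < a ⊎ b ≡ a → _
        b≤a⇒ (inj₁ b<a) = inj₁ b<a
        b≤a⇒ (inj₂ b≡a) = inj₂ (b≡a , <⇒≤ ty<tx)

1^0^-wordRepresentable : ∀ l m n → 0 < m → 0 < n → WordRepresentable (Toeplitz (1^ l 0^ m) n)
1^0^-wordRepresentable l (suc j) n _ 0<n =
  wordRepresentable (Toeplitz (1^ l 0^ suc j) n) (toeplitz-sym (1^ l 0^ suc j)) adjacent⇔
  where
    p = l + suc j
    instance
      n-nonZero : NonZero n
      n-nonZero = >-nonZero 0<n
      p-nonZero : NonZero p
      p-nonZero = >-nonZero (<-≤-trans z<s (m≤n+m (suc j) l))
    ρ : Fin n → ℕ
    ρ x = (p * n ∸ toℕ x) % p
    j<p : j < p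
    j<p = m≤n+m (suc j) l
    open PhaseClocks n p j ρ toℕ j<p (λ x → m%n<n _ p) toℕ<n toℕ-injective
      using (XFirst; YFirst; wordRepresentable)
    adjacent⇔ : ∀ {x y} → toℕ x < toℕ y → Toeplitz (1^ l 0^ suc j) n x y ⇔ (XFirst x y ⊎ YFirst x y)
    adjacent⇔ {x} {y} x<y with <⇒≡+suc x<y
    ... | e , y≡x+1+e =
      ⇔-sym (first⇔-1^0^ x<y z<s (m%n<n e p) ρ-step) ⇔-∘ toeplitz-1^0^ e y≡x+1+e l (suc j)
      where
        pn∸x≡pn∸y+1+e : p * n ∸ toℕ x ≡ p * n ∸ toℕ y + suc e
        pn∸x≡pn∸y+1+e = subst (λ y′ → p * n ∸ toℕ x ≡ p * n ∸ y′ + suc e) (sym y≡x+1+e)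
          (m∸n≡m∸[n+o]+o {b = toℕ x} (subst (_≤ p * n) y≡x+1+e (≤-trans (<⇒≤ (toℕ<n y)) (m≤n*m n p))))
        ρ-step : ρ x ≡ ρ y + suc (e % p) ⊎ ρ x + p ≡ ρ y + suc (e % p)
        ρ-step rewrite pn∸x≡pn∸y+1+e = [a+1+e]%p-cases (p * n ∸ toℕ y) e

0^1^-wordRepresentable : ∀ k l n → 0 < l → 0 < n → WordRepresentable (Toeplitz (0^ k 1^ l) n)
0^1^-wordRepresentable k l n 0<l 0<n =
  wordRepresentable (Toeplitz (0^ k 1^ l) n) (toeplitz-sym (0^ k 1^ l)) adjacent⇔
  where
    p = k + l
    instance
      n-nonZero : NonZero n
      n-nonZero = >-nonZero 0<n
      p-nonZero : NonZero p
      p-nonZero = >-nonZero (<-≤-trans 0<l (m≤n+m l k))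
    ρ τ : Fin n → ℕ
    ρ x = toℕ x % p
    τ x = toℕ (opposite x)
    k<p : k < p
    k<p = subst (_≤ p) (+-comm k 1) (+-monoʳ-≤ k 0<l)
    τ-injective : ∀ {x y} → τ x ≡ τ y → x ≡ y
    τ-injective {x} {y} τx≡τy =
      trans (sym (opposite-involutive x)) (trans (cong opposite (toℕ-injective τx≡τy)) (opposite-involutive y))
    open PhaseClocks n p k ρ τ k<p (λ x → m%n<n _ p) (toℕ<n ∘ opposite) τ-injective
      using (XFirst; YFirst; wordRepresentable)
    adjacent⇔ : ∀ {x y} → toℕ x < toℕ y → Toeplitz (0^ k 1^ l) n x y ⇔ (XFirst x y ⊎ YFirst x y)
    adjacent⇔ {x} {y} x<y with <⇒≡+suc x<y
    ... | e , y≡x+1+e =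
      ⇔-sym (first⇔-0^1^ τy<τx z<s (m%n<n e p) ρ-step) ⇔-∘ toeplitz-0^1^ e y≡x+1+e k l
      where
        τy<τx : τ y < τ x
        τy<τx = subst₂ _<_ (sym (opposite-prop y)) (sym (opposite-prop x)) (∸-monoʳ-< (s≤s x<y) (toℕ<n y))
        ρ-step : ρ y ≡ ρ x + suc (e % p) ⊎ ρ y + p ≡ ρ x + suc (e % p)
        ρ-step rewrite y≡x+1+e = [a+1+e]%p-cases (toℕ x) e

corollary6 : (k l m n : ℕ) → 0 < k → 0 < l → 0 < m → 0 < n →
    WordRepresentable (Toeplitz (0^ k 1^ l) n) ×
    WordRepresentable (Toeplitz (1^ l 0^ m) n)
corollary6 k l m n _ 0<l 0<m 0<n =
  0^1^-wordRepresentable k l n 0<l 0<n , 1^0^-wordRepresentable l m n 0<m 0<n
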